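{- Let $\Gamma$ be a distance-regular graph of diameter $d$ with intersection numbers $p_{x,y}^k$, and let $G$ be an automorphism group of $\Gamma$ acting on the vertex set with $n$ orbits, all of the same length. For $i=0,\dots,d$ let $M_i$ be the $n\times n$ quotient matrix of the distance-$i$ matrix $A_i$ of $\Gamma$ with respect to the orbit partition of $G$. Let $I=\{i_1,\dots,i_t\}\subseteq\{0,1,\dots,d\}$ and let $p$ be a prime such that $p$ divides $p_{x,y}^k$ for all $k\in\{0,1,\dots,d\}$ and all $x,y\in I$. Let $q=p^m$. Then the set of row spaces (in $\mathbb{F}_q^n$) of the elements of the matrix algebra over $\mathbb{F}_q$ generated by the matrices $M_i$, $i\in I$ (entries reduced modulo $p$), forms a self-orthogonal subspace code $C_S$ in $\mathbb{F}_q^n$.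
   Context: For a connected graph $\Gamma$ of diameter $d$, the distance-$i$ matrix $A_i$ has $(u,v)$-entry $1$ if the distance between $u,v$ is $i$ and $0$ otherwise. $\Gamma$ is distance-regular if for all $0\le x,y,k\le d$ there is a constant $p_{x,y}^k$ such that any vertices $v,w$ at distance $k$ satisfy $|\{z:\delta(v,z)=x,\ \delta(z,w)=y\}|=p_{x,y}^k$. For a partition of the vertex set into cells $C_0,\dots,C_{n-1}$ equitable for the graph with adjacency matrix $A_i$ (every vertex of $C_a$ has the same number $b_{a,b}$ of $A_i$-neighbours in $C_b$), the quotient matrix is $(b_{a,b})$. The matrix algebra generated by a set of matrices means the set of all $\mathbb{F}_q$-linear combinations of finite (nonempty) products of these matrices. A subspace code is a nonempty set $C_S$ of subspaces of $\mathbb{F}_q^n$. Its dual $C_S^\perp$ is the set of all subspaces of $\mathbb{F}_q^n$ orthogonal (standard inner product) to every subspace in $C_S$; $C_S$ is self-orthogonal if $C_S\subseteq C_S^\perp$. -}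

module Defs where

open import Level using (Level; _⊔_) renaming (suc to lsuc; zero to lzero)
open import Data.Nat using (ℕ; zero; suc) renaming (_+_ to _+ℕ_)
open import Data.Bool using (Bool; true; false; _∧_; _∨_; not; if_then_else_)
open import Data.Fin using (Fin; zero; suc; toℕ; _≟_)
open import Data.Fin.Subset using (Subset; _∈_)
open import Data.Product using (Σ; ∃; ∃-syntax; _×_; _,_)
open import Function using (_∘_; id; _⇔_)
open import Relation.Nullary using (¬_)
open import Relation.Nullary.Decidable using (⌊_⌋)
open import Relation.Binary.PropositionalEquality using (_≡_)
open import Algebra.Bundles using (CommutativeRing)

Graph : ℕ → Set
Graph N = Fin N → Fin N → Bool

record IsSimpleGraph {N : ℕ} (adj : Graph N) : Set where
  field
    symmetric   : ∀ u v → adj u v ≡ adj v u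
    irreflexive : ∀ u → adj u u ≡ false

count : {N : ℕ} → (Fin N → Bool) → ℕ
count {zero}  f = 0
count {suc N} f = (if f zero then 1 else 0) +ℕ count (f ∘ suc)

anyFin : {N : ℕ} → (Fin N → Bool) → Bool
anyFin {zero}  f = false
anyFin {suc N} f = f zero ∨ anyFin (f ∘ suc)

-- reach adj k u v = true  iff  δ(u,v) ≤ k
reach : {N : ℕ} → Graph N → ℕ → Fin N → Fin N → Bool
reach adj zero    u v = ⌊ u ≟ v ⌋
reach adj (suc k) u v = reach adj k u v ∨ anyFin (λ w → reach adj k u w ∧ adj w v)

-- distIs adj i u v = true  iff  δ(u,v) = i   (entry (u,v) of A_i)
distIs : {N : ℕ} → Graph N → ℕ → Fin N → Fin N → Bool
distIs adj zero    u v = reach adj zero u v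
distIs adj (suc i) u v = reach adj (suc i) u v ∧ not (reach adj i u v)

Connected : {N : ℕ} → Graph N → Set
Connected adj = ∀ u v → ∃[ k ] reach adj k u v ≡ true

HasDiameter : {N : ℕ} → Graph N → ℕ → Set
HasDiameter adj d =
  (∀ u v → reach adj d u v ≡ true) × (∃[ u ] ∃[ v ] distIs adj d u v ≡ true)

-- distance-regular of diameter d with intersection numbers pn x y k = p^k_{x,y}
IsDistanceRegular : {N : ℕ} → Graph N → (d : ℕ) →
                    (Fin (suc d) → Fin (suc d) → Fin (suc d) → ℕ) → Set
IsDistanceRegular adj d pn =
  ∀ (x y k : Fin (suc d)) v w → distIs adj (toℕ k) v w ≡ true →
    count (λ z → distIs adj (toℕ x) v z ∧ distIs adj (toℕ y) z w) ≡ pn x y k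

record IsAutomorphismGroup {N : ℕ} (adj : Graph N) (G : (Fin N → Fin N) → Set) : Set where
  field
    contains-id : G id
    closed-comp : ∀ {g h} → G g → G h → G (g ∘ h)
    closed-inv  : ∀ {g} → G g →
                  Σ (Fin N → Fin N) λ h → G h × (∀ u → h (g u) ≡ u) × (∀ u → g (h u) ≡ u)
    automorphism : ∀ {g} → G g → ∀ u v → adj (g u) (g v) ≡ adj u v

record IsOrbitLabelling {N n : ℕ} (G : (Fin N → Fin N) → Set) (orb : Fin N → Fin n) : Set where
  field
    surjective : ∀ a → ∃[ u ] orb u ≡ a
    sameOrbit  : ∀ u v → (orb u ≡ orb v) ⇔ (∃[ g ] (G g × g u ≡ v))

EqualOrbitLengths : {N n : ℕ} → (Fin N → Fin n) → Set
EqualOrbitLengths orb = ∀ a b → count (λ u → ⌊ orb u ≟ a ⌋) ≡ count (λ u → ⌊ orb u ≟ b ⌋)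

IsQuotientMatrix : {N n : ℕ} → Graph N → (Fin N → Fin n) → ℕ → (Fin n → Fin n → ℕ) → Set
IsQuotientMatrix adj orb i B =
  ∀ u b → count (λ z → distIs adj i u z ∧ ⌊ orb z ≟ b ⌋) ≡ B (orb u) b

record IsField {c ℓ : Level} (F : CommutativeRing c ℓ) : Set (c ⊔ ℓ) where
  open CommutativeRing F using (Carrier; _≈_; _+_; _*_; 0#; 1#)
  field
    0≉1     : ¬ (0# ≈ 1#)
    inverse : ∀ x → ¬ (x ≈ 0#) → ∃[ y ] (x * y ≈ 1#)

module LinAlg {c ℓ : Level} (F : CommutativeRing c ℓ) where
  open CommutativeRing F using (Carrier; _≈_; _+_; _*_; 0#; 1#)

  -- canonical image of a natural number in F (reduction modulo the characteristic)
  ι : ℕ → Carrier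
  ι zero    = 0#
  ι (suc k) = 1# + ι k

  ∑ : {n : ℕ} → (Fin n → Carrier) → Carrier
  ∑ {zero}  f = 0#
  ∑ {suc n} f = f zero + ∑ (f ∘ suc)

  Vector : ℕ → Set c
  Vector n = Fin n → Carrier

  Matrix : ℕ → Set c
  Matrix n = Fin n → Fin n → Carrier

  _⊗_ : {n : ℕ} → Matrix n → Matrix n → Matrix n
  (X ⊗ Y) a b = ∑ (λ k → X a k * Y k b)

  _⊕_ : {n : ℕ} → Matrix n → Matrix n → Matrix n
  (X ⊕ Y) a b = X a b + Y a b

  _·ₘ_ : {n : ℕ} → Carrier → Matrix n → Matrix n
  (s ·ₘ X) a b = s * X a b

  zeroM : {n : ℕ} → Matrix n
  zeroM a b = 0#

  reduce : {n : ℕ} → (Fin n → Fin n → ℕ) → Matrix n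
  reduce B a b = ι (B a b)

  _∙_ : {n : ℕ} → Vector n → Vector n → Carrier
  u ∙ w = ∑ (λ k → u k * w k)

  Subspace : ℕ → Set (lsuc (c ⊔ ℓ))
  Subspace n = Vector n → Set (c ⊔ ℓ)

  RowSpace : {n : ℕ} → Matrix n → Subspace n
  RowSpace {n} X v = Σ (Vector n) λ coeff → (∀ b → v b ≈ ∑ (λ a → coeff a * X a b))

  Orthogonal : {n : ℕ} → Subspace n → Subspace n → Set (c ⊔ ℓ)
  Orthogonal U W = ∀ u w → U u → W w → (u ∙ w) ≈ 0#

  -- a subspace code given as an indexed family of subspaces; self-orthogonal
  -- means it is nonempty and every member lies in the dual code, i.e. is
  -- orthogonal to every member.
  IsSelfOrthogonalCode : {n : ℕ} {a : Level} {Idx : Set a} → (Idx → Subspace n) → Set (a ⊔ c ⊔ ℓ)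
  IsSelfOrthogonalCode {Idx = Idx} code = Idx × (∀ i j → Orthogonal (code i) (code j))

  -- the matrix algebra generated by the reductions of the matrices M i, i ∈ I:
  -- Prod = finite nonempty products of generators,
  -- InAlgebra = F-linear combinations of such products
  module _ {n d : ℕ} (M : Fin (suc d) → Fin n → Fin n → ℕ) (I : Subset (suc d)) where
    data Prod : Matrix n → Set c where
      gen : ∀ i → i ∈ I → Prod (reduce (M i))
      mul : ∀ {X Y} → Prod X → Prod Y → Prod (X ⊗ Y)

    data InAlgebra : Matrix n → Set c where
      zeroA : InAlgebra zeroM
      addA  : ∀ {P X} (s : Carrier) → Prod P → InAlgebra X → InAlgebra ((s ·ₘ P) ⊕ X)

    AlgebraElement : Set c
    AlgebraElement = Σ (Matrix n) InAlgebra

    rowSpaceCode : AlgebraElement → Subspace n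
    rowSpaceCode (X , _) = RowSpace X

module Submission where

open import Defs
open import Level using (Level)
open import Data.Nat using (ℕ; suc; _^_; _≤_)
open import Data.Nat.Divisibility using (_∣_)
open import Data.Nat.Primality using (Prime)
open import Data.Fin using (Fin; toℕ)
open import Data.Fin.Subset using (Subset; _∈_)
open import Function.Bundles using (Inverse)
open import Algebra.Bundles using (CommutativeRing)
open import Relation.Binary.PropositionalEquality using (setoid)

open import Algebra.Bundles using (CommutativeSemiring)
import Data.Nat as ℕ
open import Data.Nat.Properties using (+-*-commutativeSemiring)
open import Data.Nat.Divisibility using (divides)
open import Data.Fin using (zero; suc; _≟_; punchIn; inject₁; fromℕ)
open import Data.Product using (_,_)
open import Function using (_∘_)
open import Relation.Binary.PropositionalEquality as ≡ using (_≡_)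

-- Let χ be the characteristic matrix of the orbit partition and A_i the
-- distance matrices. Equitability says A_i χ = χ M_i. As A_i is symmetric and
-- all cells have the same size s, χᵀ A_i χ = s M_i forces M_i to be symmetric.
-- Hence χ M_x M_yᵀ = χ M_x M_y = A_x A_y χ, and each entry of A_x A_y is an
-- intersection number p^k_{x,y}, so M_x M_yᵀ ≡ 0 mod p. The relation X Yᵀ = 0
-- survives left multiplication of X or Y and linear combinations, so any two
-- elements of the generated algebra have orthogonal row spaces. Connectedness,
-- the group structure of G and all field hypotheses except ι p = 0 are unused.

module SemiringSums {c ℓ : Level} (R : CommutativeSemiring c ℓ) where
  open CommutativeSemiring R hiding (setoid)
  open import Algebra.Properties.Semiring.Sum semiring public
  open import Relation.Binary.Reasoning.Setoid (CommutativeSemiring.setoid R)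

  ∑-zero : ∀ {n} (f : Fin n → Carrier) → (∀ i → f i ≈ 0#) → ∑[ i < n ] f i ≈ 0#
  ∑-zero {n} f f≈0 = trans (sum-cong-≋ f≈0) (sum-replicate-zero n)

  ∑-∑-assoc : ∀ {m n} (f : Fin m → Carrier) (g : Fin m → Fin n → Carrier) (h : Fin n → Carrier) →
              ∑[ j < n ] (∑[ i < m ] (f i * g i j) * h j) ≈ ∑[ i < m ] (f i * ∑[ j < n ] (g i j * h j))
  ∑-∑-assoc {m} {n} f g h = begin
    ∑[ j < n ] (∑[ i < m ] (f i * g i j) * h j)
      ≈⟨ sum-cong-≋ (λ j → *-distribʳ-sum (h j) (λ i → f i * g i j)) ⟩
    ∑[ j < n ] ∑[ i < m ] (f i * g i j * h j)
      ≈⟨ ∑-comm (λ j i → f i * g i j * h j) ⟩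
    ∑[ i < m ] ∑[ j < n ] (f i * g i j * h j)
      ≈⟨ sum-cong-≋ (λ i → sum-cong-≋ (λ j → *-assoc (f i) (g i j) (h j))) ⟩
    ∑[ i < m ] ∑[ j < n ] (f i * (g i j * h j))
      ≈⟨ sum-cong-≋ (λ i → *-distribˡ-sum (f i) (λ j → g i j * h j)) ⟨
    ∑[ i < m ] (f i * ∑[ j < n ] (g i j * h j))
      ∎

  orthogonal-rowCombination : ∀ {m n} (α : Fin m → Carrier) (X : Fin m → Fin n → Carrier) w →
                              (∀ a → ∑[ b < n ] (X a b * w b) ≈ 0#) →
                              ∑[ b < n ] (∑[ a < m ] (α a * X a b) * w b) ≈ 0#
  orthogonal-rowCombination α X w X⊥w =
    trans (∑-∑-assoc α X w) (∑-zero _ (λ a → trans (*-congˡ (X⊥w a)) (zeroʳ (α a))))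

module RowOrthogonality {c ℓ : Level} (F : CommutativeRing c ℓ) where
  open CommutativeRing F hiding (zero; setoid)
  open LinAlg F
  open SemiringSums commutativeSemiring
  open SemiringSums +-*-commutativeSemiring using () renaming (sum to ∑ℕ)
  open import Algebra.Properties.Semiring.Mult semiring using (_×_; ×-homo-+; ×1-homo-*)
  open import Relation.Binary.Reasoning.Setoid (CommutativeRing.setoid F)

  ∑≡sum : ∀ {n} (f : Vector n) → ∑ f ≡ sum f
  ∑≡sum {ℕ.zero}  f = ≡.refl
  ∑≡sum {ℕ.suc n} f = ≡.cong (f zero +_) (∑≡sum (f ∘ suc))

  RowOrthogonal : ∀ {n} → Matrix n → Matrix n → Set ℓ
  RowOrthogonal {n} X Y = ∀ a b → ∑[ k < n ] (X a k * Y b k) ≈ 0#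

  rowOrthogonal-sym : ∀ {n} {X Y : Matrix n} → RowOrthogonal X Y → RowOrthogonal Y X
  rowOrthogonal-sym {X = X} {Y} X⊥Y a b = trans (sum-cong-≋ (λ k → *-comm (Y a k) (X b k))) (X⊥Y b a)

  rowOrthogonal-⊗ˡ : ∀ {n} {X Y Z : Matrix n} → RowOrthogonal Y Z → RowOrthogonal (X ⊗ Y) Z
  rowOrthogonal-⊗ˡ {X = X} {Y} {Z} Y⊥Z a c =
    trans (sum-cong-≋ (λ b → *-congʳ (reflexive (∑≡sum (λ k → X a k * Y k b)))))
          (orthogonal-rowCombination (X a) Y (Z c) (λ k → Y⊥Z k c))

  rowOrthogonal-⊗ʳ : ∀ {n} {X Y Z : Matrix n} → RowOrthogonal Z Y → RowOrthogonal Z (X ⊗ Y)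
  rowOrthogonal-⊗ʳ Z⊥Y = rowOrthogonal-sym (rowOrthogonal-⊗ˡ (rowOrthogonal-sym Z⊥Y))

  rowOrthogonal-zeroM : ∀ {n} {Y : Matrix n} → RowOrthogonal zeroM Y
  rowOrthogonal-zeroM {Y = Y} a b = ∑-zero _ (λ k → zeroˡ (Y b k))

  rowOrthogonal-⊕ : ∀ {n} {X Y Z : Matrix n} s → RowOrthogonal X Z → RowOrthogonal Y Z →
                    RowOrthogonal ((s ·ₘ X) ⊕ Y) Z
  rowOrthogonal-⊕ {n} {X} {Y} {Z} s X⊥Z Y⊥Z a c = begin
    ∑[ b < n ] ((s * X a b + Y a b) * Z c b)
      ≈⟨ sum-cong-≋ (λ b → distribʳ (Z c b) (s * X a b) (Y a b)) ⟩
    ∑[ b < n ] (s * X a b * Z c b + Y a b * Z c b)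
      ≈⟨ ∑-distrib-+ (λ b → s * X a b * Z c b) (λ b → Y a b * Z c b) ⟩
    ∑[ b < n ] (s * X a b * Z c b) + ∑[ b < n ] (Y a b * Z c b)
      ≈⟨ +-congʳ (sum-cong-≋ (λ b → *-assoc s (X a b) (Z c b))) ⟩
    ∑[ b < n ] (s * (X a b * Z c b)) + ∑[ b < n ] (Y a b * Z c b)
      ≈⟨ +-congʳ (*-distribˡ-sum s (λ b → X a b * Z c b)) ⟨
    s * ∑[ b < n ] (X a b * Z c b) + ∑[ b < n ] (Y a b * Z c b)
      ≈⟨ +-cong (*-congˡ (X⊥Z a c)) (Y⊥Z a c) ⟩
    s * 0# + 0#
      ≈⟨ trans (+-identityʳ (s * 0#)) (zeroʳ s) ⟩
    0#
      ∎

  rowSpace-orthogonal : ∀ {n} {X Y : Matrix n} → RowOrthogonal X Y → Orthogonal (RowSpace X) (RowSpace Y)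
  rowSpace-orthogonal {n} {X} {Y} X⊥Y u w (α , u≈αX) (β , w≈βY) = begin
    u ∙ w
      ≡⟨ ∑≡sum (λ b → u b * w b) ⟩
    ∑[ b < n ] (u b * w b)
      ≈⟨ sum-cong-≋ (λ b → *-congʳ (combination u α X u≈αX b)) ⟩
    ∑[ b < n ] (∑[ a < n ] (α a * X a b) * w b)
      ≈⟨ orthogonal-rowCombination α X w X⊥w ⟩
    0#
      ∎
    where
    combination : ∀ v γ (Z : Matrix n) → (∀ b → v b ≈ ∑ (λ a → γ a * Z a b)) →
                  ∀ b → v b ≈ ∑[ a < n ] (γ a * Z a b)
    combination v γ Z v≈γZ b = trans (v≈γZ b) (reflexive (∑≡sum (λ a → γ a * Z a b)))

    X⊥w : ∀ a → ∑[ b < n ] (X a b * w b) ≈ 0#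
    X⊥w a = begin
      ∑[ b < n ] (X a b * w b)
        ≈⟨ sum-cong-≋ (λ b → *-comm (X a b) (w b)) ⟩
      ∑[ b < n ] (w b * X a b)
        ≈⟨ sum-cong-≋ (λ b → *-congʳ (combination w β Y w≈βY b)) ⟩
      ∑[ b < n ] (∑[ c < n ] (β c * Y c b) * X a b)
        ≈⟨ orthogonal-rowCombination β Y (X a) (λ c → rowOrthogonal-sym {X = X} {Y} X⊥Y c a) ⟩
      0#
        ∎

  module _ {n d : ℕ} (M : Fin (suc d) → Fin n → Fin n → ℕ) (I : Subset (suc d))
           (generators-rowOrthogonal : ∀ x y → x ∈ I → y ∈ I →
                                       RowOrthogonal (reduce (M x)) (reduce (M y))) where

    prod-rowOrthogonal : ∀ {P Q} → Prod M I P → Prod M I Q → RowOrthogonal P Q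
    prod-rowOrthogonal (gen x x∈I) (gen y y∈I) = generators-rowOrthogonal x y x∈I y∈I
    prod-rowOrthogonal P           (mul _ Q)   = rowOrthogonal-⊗ʳ (prod-rowOrthogonal P Q)
    prod-rowOrthogonal (mul _ P)   Q@(gen _ _) = rowOrthogonal-⊗ˡ (prod-rowOrthogonal P Q)

    algebra-prod-rowOrthogonal : ∀ {X Q} → InAlgebra M I X → Prod M I Q → RowOrthogonal X Q
    algebra-prod-rowOrthogonal zeroA        Q = rowOrthogonal-zeroM
    algebra-prod-rowOrthogonal (addA s P X) Q =
      rowOrthogonal-⊕ s (prod-rowOrthogonal P Q) (algebra-prod-rowOrthogonal X Q)

    algebra-rowOrthogonal : ∀ {X Y} → InAlgebra M I X → InAlgebra M I Y → RowOrthogonal X Y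
    algebra-rowOrthogonal X zeroA        = rowOrthogonal-sym rowOrthogonal-zeroM
    algebra-rowOrthogonal X (addA s Q Y) = rowOrthogonal-sym
      (rowOrthogonal-⊕ s (rowOrthogonal-sym (algebra-prod-rowOrthogonal X Q))
                         (rowOrthogonal-sym (algebra-rowOrthogonal X Y)))

    rowSpaceCode-selfOrthogonal : IsSelfOrthogonalCode (rowSpaceCode M I)
    rowSpaceCode-selfOrthogonal =
      (zeroM , zeroA) , λ (X , X∈A) (Y , Y∈A) → rowSpace-orthogonal (algebra-rowOrthogonal X∈A Y∈A)

  ι≡×1# : ∀ k → ι k ≡ k × 1#
  ι≡×1# ℕ.zero    = ≡.refl
  ι≡×1# (ℕ.suc k) = ≡.cong (1# +_) (ι≡×1# k)

  ι-homo-+ : ∀ m n → ι (m ℕ.+ n) ≈ ι m + ι n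
  ι-homo-+ m n = begin
    ι (m ℕ.+ n)              ≡⟨ ι≡×1# (m ℕ.+ n) ⟩
    (m ℕ.+ n) × 1#           ≈⟨ ×-homo-+ 1# m n ⟩
    m × 1# + n × 1#          ≡⟨ ≡.cong₂ _+_ (ι≡×1# m) (ι≡×1# n) ⟨
    ι m + ι n                ∎

  ι-homo-* : ∀ m n → ι (m ℕ.* n) ≈ ι m * ι n
  ι-homo-* m n = begin
    ι (m ℕ.* n)              ≡⟨ ι≡×1# (m ℕ.* n) ⟩
    (m ℕ.* n) × 1#           ≈⟨ ×1-homo-* m n ⟩
    (m × 1#) * (n × 1#)      ≡⟨ ≡.cong₂ _*_ (ι≡×1# m) (ι≡×1# n) ⟨
    ι m * ι n                ∎

  ι-homo-∑ : ∀ {n} (f : Fin n → ℕ) → ι (∑ℕ f) ≈ ∑[ i < n ] ι (f i)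
  ι-homo-∑ {ℕ.zero}  f = refl
  ι-homo-∑ {ℕ.suc n} f = trans (ι-homo-+ (f zero) (∑ℕ (f ∘ suc))) (+-congˡ (ι-homo-∑ (f ∘ suc)))

  ι-∣ : ∀ {p k} → ι p ≈ 0# → p ∣ k → ι k ≈ 0#
  ι-∣ {p} ιp≈0 (divides q ≡.refl) = trans (ι-homo-* q p) (trans (*-congˡ ιp≈0) (zeroʳ (ι q)))

  reduce-rowOrthogonal : ∀ {n p} {B B' : Fin n → Fin n → ℕ} → ι p ≈ 0# →
                         (∀ a b → p ∣ ∑ℕ (λ c → B a c ℕ.* B' b c)) →
                         RowOrthogonal (reduce B) (reduce B')
  reduce-rowOrthogonal {n} {B = B} {B'} ιp≈0 p∣BB'ᵀ a b = begin
    ∑[ c < n ] (ι (B a c) * ι (B' b c))     ≈⟨ sum-cong-≋ (λ c → ι-homo-* (B a c) (B' b c)) ⟨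
    ∑[ c < n ] ι (B a c ℕ.* B' b c)         ≈⟨ ι-homo-∑ (λ c → B a c ℕ.* B' b c) ⟨
    ι (∑ℕ (λ c → B a c ℕ.* B' b c))         ≈⟨ ι-∣ ιp≈0 (p∣BB'ᵀ a b) ⟩
    0#                                      ∎

open import Data.Bool using (Bool; true; false; _∧_; _∨_; not; if_then_else_)
open import Data.Bool.Properties using (∨-zeroʳ; ∧-conicalˡ; ∧-conicalʳ; ¬-not)
import Data.Bool.Properties as Bool
open import Data.Nat using (zero; _+_; _*_; NonZero; >-nonZero)
open import Data.Nat.Properties using (*-comm; *-cancelˡ-≡; *-identityˡ; +-identityʳ; m≤m+n)
open import Data.Nat.Divisibility using (_∣0; ∣m∣n⇒∣m+n; ∣m⇒∣m*n)
open import Data.Fin.Properties using (punchInᵢ≢i; toℕ-inject₁; toℕ-fromℕ)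
open import Data.Product using (∃; ∃-syntax; _×_; proj₁)
open import Data.Sum using (_⊎_; inj₁; inj₂)
open import Relation.Nullary.Decidable using (⌊_⌋; yes; no)
open import Relation.Binary.PropositionalEquality
  using (refl; sym; trans; cong; cong₂; subst; ≡-≟-identity; ≢-≟-identity; module ≡-Reasoning)

open SemiringSums +-*-commutativeSemiring
  using (sum-syntax; sum-cong-≗; sum-remove; ∑-zero; ∑-∑-assoc; *-distribʳ-sum)

𝟙 : Bool → ℕ
𝟙 b = if b then 1 else 0

𝟙-∧ : ∀ a b → 𝟙 (a ∧ b) ≡ 𝟙 a * 𝟙 b
𝟙-∧ true  b = sym (+-identityʳ (𝟙 b))
𝟙-∧ false b = refl

count≡∑ : ∀ {N} (f : Fin N → Bool) → count f ≡ ∑[ i < N ] 𝟙 (f i)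
count≡∑ {zero}  f = refl
count≡∑ {suc N} f = cong (𝟙 (f zero) +_) (count≡∑ (f ∘ suc))

count-∧ : ∀ {N} (f g : Fin N → Bool) → count (λ z → f z ∧ g z) ≡ ∑[ z < N ] (𝟙 (f z) * 𝟙 (g z))
count-∧ f g = trans (count≡∑ (λ z → f z ∧ g z)) (sum-cong-≗ (λ z → 𝟙-∧ (f z) (g z)))

∣-∑ : ∀ {N d} (f : Fin N → ℕ) → (∀ i → d ∣ f i) → d ∣ ∑[ i < N ] f i
∣-∑ {zero}  {d} f d∣f = d ∣0
∣-∑ {suc N}     f d∣f = ∣m∣n⇒∣m+n (d∣f zero) (∣-∑ (f ∘ suc) (d∣f ∘ suc))

≤-∑ : ∀ {N} (f : Fin N → ℕ) i → f i ≤ ∑[ j < N ] f j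
≤-∑ {suc N} f i rewrite sum-remove {i = i} f = m≤m+n _ _

∑-δ : ∀ {n} (o : Fin n) (h : Fin n → ℕ) → ∑[ c < n ] (𝟙 ⌊ o ≟ c ⌋ * h c) ≡ h o
∑-δ {suc n} o h = begin
  ∑[ c < suc n ] term c                     ≡⟨ sum-remove {i = o} term ⟩
  term o + ∑[ c < n ] term (punchIn o c)    ≡⟨ cong₂ _+_ diagonal (∑-zero _ off-diagonal) ⟩
  1 * h o + 0                               ≡⟨ trans (+-identityʳ (1 * h o)) (*-identityˡ (h o)) ⟩
  h o                                       ∎
  where
  open ≡-Reasoning
  term : Fin (suc n) → ℕ
  term c = 𝟙 ⌊ o ≟ c ⌋ * h c
  diagonal : term o ≡ 1 * h o
  diagonal = cong (λ d → 𝟙 ⌊ d ⌋ * h o) (≡-≟-identity _≟_ {o} refl)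
  off-diagonal : ∀ c → term (punchIn o c) ≡ 0
  off-diagonal c =
    cong (λ d → 𝟙 ⌊ d ⌋ * h (punchIn o c)) (≢-≟-identity _≟_ (punchInᵢ≢i o c ∘ sym))

_⊙_ : ∀ {l m n} → (Fin l → Fin m → ℕ) → (Fin m → Fin n → ℕ) → Fin l → Fin n → ℕ
(X ⊙ Y) i k = ∑[ j < _ ] (X i j * Y j k)

module EquitablePartition {N n : ℕ} (orb : Fin N → Fin n) where

  χ : Fin n → Fin N → ℕ
  χ c w = 𝟙 ⌊ orb w ≟ c ⌋

  cellSize : Fin n → ℕ
  cellSize c = ∑[ w < N ] χ c w

  record IsQuotientOf (D : Fin N → Fin N → ℕ) (B : Fin n → Fin n → ℕ) : Set where
    field cellSum : ∀ u b → ∑[ z < N ] (D u z * χ b z) ≡ B (orb u) b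

  open IsQuotientOf

  χ-orb : ∀ u → χ (orb u) u ≡ 1
  χ-orb u = cong (𝟙 ∘ ⌊_⌋) (≡-≟-identity _≟_ refl)

  χ-*-orb : ∀ (g : Fin n → ℕ) c w → χ c w * g (orb w) ≡ χ c w * g c
  χ-*-orb g c w with orb w ≟ c
  ... | yes refl = refl
  ... | no _     = refl

  ∑-χ-*-orb : ∀ (g : Fin n → ℕ) c → ∑[ w < N ] (χ c w * g (orb w)) ≡ cellSize c * g c
  ∑-χ-*-orb g c = trans (sum-cong-≗ (χ-*-orb g c)) (sym (*-distribʳ-sum (g c) (χ c)))

  cellSize-nonZero : (∀ c → ∃[ u ] orb u ≡ c) → ∀ c → NonZero (cellSize c)
  cellSize-nonZero surjective c with surjective c
  ... | u , refl = >-nonZero (subst (_≤ cellSize (orb u)) (χ-orb u) (≤-∑ (χ (orb u)) u))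

  cellSize-equal : EqualOrbitLengths orb → ∀ b c → cellSize b ≡ cellSize c
  cellSize-equal equal b c = trans (sym (count≡∑ (inCell b))) (trans (equal b c) (count≡∑ (inCell c)))
    where
    inCell : Fin n → Fin N → Bool
    inCell a u = ⌊ orb u ≟ a ⌋

  quotient-⊙ : ∀ {D D' B B'} → IsQuotientOf D B → IsQuotientOf D' B' → IsQuotientOf (D ⊙ D') (B ⊙ B')
  quotient-⊙ {D} {D'} {B} {B'} q q' .cellSum u b = begin
    ∑[ w < N ] ((D ⊙ D') u w * χ b w)
      ≡⟨ ∑-∑-assoc (D u) D' (χ b) ⟩
    ∑[ z < N ] (D u z * ∑[ w < N ] (D' z w * χ b w))
      ≡⟨ sum-cong-≗ (λ z → cong (D u z *_) (cellSum q' z b)) ⟩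
    ∑[ z < N ] (D u z * B' (orb z) b)
      ≡⟨ sum-cong-≗ (λ z → cong (D u z *_) (∑-δ (orb z) (λ c → B' c b))) ⟨
    ∑[ z < N ] (D u z * ∑[ c < n ] (χ c z * B' c b))
      ≡⟨ ∑-∑-assoc (D u) (λ z c → χ c z) (λ c → B' c b) ⟨
    ∑[ c < n ] (∑[ z < N ] (D u z * χ c z) * B' c b)
      ≡⟨ sum-cong-≗ (λ c → cong (_* B' c b) (cellSum q u c)) ⟩
    ∑[ c < n ] (B (orb u) c * B' c b)
      ∎
    where open ≡-Reasoning

  quotient-∣ : ∀ {D B d} → (∀ c → ∃[ u ] orb u ≡ c) → IsQuotientOf D B → (∀ u v → d ∣ D u v) →
               ∀ a b → d ∣ B a b
  quotient-∣ surjective q d∣D a b with surjective a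
  ... | u , refl = subst (_ ∣_) (cellSum q u b) (∣-∑ _ (λ z → ∣m⇒∣m*n (χ b z) (d∣D u z)))

  blockSum : (Fin N → Fin N → ℕ) → Fin n → Fin n → ℕ
  blockSum D c b = ∑[ w < N ] (χ c w * ∑[ z < N ] (D w z * χ b z))

  blockSum-quotient : ∀ {D B} → IsQuotientOf D B → ∀ c b → blockSum D c b ≡ cellSize c * B c b
  blockSum-quotient {B = B} q c b =
    trans (sum-cong-≗ (λ w → cong (χ c w *_) (cellSum q w b))) (∑-χ-*-orb (λ a → B a b) c)

  blockSum-symmetric : ∀ {D} → (∀ u v → D u v ≡ D v u) → ∀ c b → blockSum D c b ≡ blockSum D b c
  blockSum-symmetric {D} D-sym c b = begin
    ∑[ w < N ] (χ c w * ∑[ z < N ] (D w z * χ b z))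
      ≡⟨ ∑-∑-assoc (χ c) D (χ b) ⟨
    ∑[ z < N ] (∑[ w < N ] (χ c w * D w z) * χ b z)
      ≡⟨ sum-cong-≗ (λ z → *-comm _ (χ b z)) ⟩
    ∑[ z < N ] (χ b z * ∑[ w < N ] (χ c w * D w z))
      ≡⟨ sum-cong-≗ (λ z → cong (χ b z *_) (sum-cong-≗ (transpose z))) ⟩
    ∑[ z < N ] (χ b z * ∑[ w < N ] (D z w * χ c w))
      ∎
    where
    open ≡-Reasoning
    transpose : ∀ z w → χ c w * D w z ≡ D z w * χ c w
    transpose z w = trans (*-comm (χ c w) (D w z)) (cong (_* χ c w) (D-sym w z))

  quotient-symmetric : ∀ {D B} → (∀ c → ∃[ u ] orb u ≡ c) → EqualOrbitLengths orb →
                       (∀ u v → D u v ≡ D v u) → IsQuotientOf D B → ∀ b c → B b c ≡ B c b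
  quotient-symmetric {D} {B} surjective equal D-sym q b c =
    *-cancelˡ-≡ (B b c) (B c b) (cellSize b) {{cellSize-nonZero surjective b}} (begin
      cellSize b * B b c     ≡⟨ blockSum-quotient {D} q b c ⟨
      blockSum D b c         ≡⟨ blockSum-symmetric D-sym b c ⟩
      blockSum D c b         ≡⟨ blockSum-quotient {D} q c b ⟩
      cellSize c * B c b     ≡⟨ cong (_* B c b) (cellSize-equal equal c b) ⟩
      cellSize b * B c b     ∎)
    where open ≡-Reasoning

≡true-ext : ∀ {a b} → (a ≡ true → b ≡ true) → (b ≡ true → a ≡ true) → a ≡ b
≡true-ext {false} {false} _   _   = refl
≡true-ext {false} {true}  _   b⇒a = b⇒a refl
≡true-ext {true}          a⇒b _   = sym (a⇒b refl)

∨-true : ∀ a {b} → a ∨ b ≡ true → a ≡ true ⊎ b ≡ true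
∨-true true  _ = inj₁ refl
∨-true false e = inj₂ e

≟-sound : ∀ {n} {x y : Fin n} → ⌊ x ≟ y ⌋ ≡ true → x ≡ y
≟-sound {x = x} {y} with x ≟ y
... | yes x≡y = λ _ → x≡y
... | no  _   = λ ()

anyFin-intro : ∀ {N} (f : Fin N → Bool) i → f i ≡ true → anyFin f ≡ true
anyFin-intro f zero    fi = cong (_∨ anyFin (f ∘ suc)) fi
anyFin-intro f (suc i) fi = trans (cong (f zero ∨_) (anyFin-intro (f ∘ suc) i fi)) (∨-zeroʳ (f zero))

anyFin-elim : ∀ {N} (f : Fin N → Bool) → anyFin f ≡ true → ∃[ i ] f i ≡ true
anyFin-elim {suc N} f e with ∨-true (f zero) e
... | inj₁ f0 = zero , f0
... | inj₂ fs with anyFin-elim (f ∘ suc) fs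
...   | i , fi = suc i , fi

module Distances {N : ℕ} (adj : Graph N) where

  reach-refl : ∀ u → reach adj 0 u u ≡ true
  reach-refl u = cong ⌊_⌋ (≡-≟-identity _≟_ refl)

  reach-mono : ∀ k {u v} → reach adj k u v ≡ true → reach adj (suc k) u v ≡ true
  reach-mono k {u} {v} uv = cong (_∨ anyFin (λ w → reach adj k u w ∧ adj w v)) uv

  reach-stepʳ : ∀ k {u w v} → reach adj k u w ≡ true → adj w v ≡ true → reach adj (suc k) u v ≡ true
  reach-stepʳ k {u} {w} {v} uw wv =
    trans (cong (reach adj k u v ∨_) (anyFin-intro _ w (cong₂ _∧_ uw wv))) (∨-zeroʳ _)

  reach-cases : ∀ k {u v} → reach adj (suc k) u v ≡ true →
                reach adj k u v ≡ true ⊎ ∃[ w ] (reach adj k u w ≡ true × adj w v ≡ true)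
  reach-cases k {u} e with ∨-true (reach adj k u _) e
  ... | inj₁ uv = inj₁ uv
  ... | inj₂ path with anyFin-elim _ path
  ...   | w , uwv = inj₂ (w , ∧-conicalˡ _ _ uwv , ∧-conicalʳ _ _ uwv)

  reach-stepˡ : ∀ k {u w v} → adj u w ≡ true → reach adj k w v ≡ true → reach adj (suc k) u v ≡ true
  reach-stepˡ zero {u} uw wv with ≟-sound wv
  ... | refl = reach-stepʳ zero (reach-refl u) uw
  reach-stepˡ (suc k) uw wv with reach-cases k wv
  ... | inj₁ wv′           = reach-mono (suc k) (reach-stepˡ k uw wv′)
  ... | inj₂ (z , wz , zv) = reach-stepʳ (suc k) (reach-stepˡ k uw wz) zv

  module _ (adj-sym : ∀ u v → adj u v ≡ adj v u) where

    reach-sym : ∀ k {u v} → reach adj k u v ≡ true → reach adj k v u ≡ true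
    reach-sym zero uv with ≟-sound uv
    ... | refl = uv
    reach-sym (suc k) uv with reach-cases k uv
    ... | inj₁ uv′           = reach-mono k (reach-sym k uv′)
    ... | inj₂ (w , uw , wv) = reach-stepˡ k (trans (adj-sym _ w) wv) (reach-sym k uw)

    reach-comm : ∀ k u v → reach adj k u v ≡ reach adj k v u
    reach-comm k u v = ≡true-ext (reach-sym k) (reach-sym k)

    distIs-comm : ∀ i u v → distIs adj i u v ≡ distIs adj i v u
    distIs-comm zero    u v = reach-comm zero u v
    distIs-comm (suc i) u v = cong₂ (λ a b → a ∧ not b) (reach-comm (suc i) u v) (reach-comm i u v)

  distance : ∀ d {u v} → reach adj d u v ≡ true → ∃[ k ] distIs adj (toℕ {suc d} k) u v ≡ true
  distance zero    uv = zero , uv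
  distance (suc d) {u} {v} uv with reach adj d u v Bool.≟ true
  ... | yes uv′ with distance d uv′
  ...   | k , dk = inject₁ k , subst (λ i → distIs adj i u v ≡ true) (sym (toℕ-inject₁ k)) dk
  distance (suc d) {u} {v} uv | no ¬uv′ =
    fromℕ (suc d) , subst (λ i → distIs adj i u v ≡ true) (sym (toℕ-fromℕ (suc d)))
                          (cong₂ (λ a b → a ∧ not b) uv (¬-not ¬uv′))

  distanceMatrix : ℕ → Fin N → Fin N → ℕ
  distanceMatrix i u v = 𝟙 (distIs adj i u v)

  distanceMatrix-symmetric : (∀ u v → adj u v ≡ adj v u) →
                             ∀ i u v → distanceMatrix i u v ≡ distanceMatrix i v u
  distanceMatrix-symmetric adj-sym i u v = cong 𝟙 (distIs-comm adj-sym i u v)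

  quotientMatrix-isQuotientOf : ∀ {n} {orb : Fin N → Fin n} i {B} → IsQuotientMatrix adj orb i B →
                                EquitablePartition.IsQuotientOf orb (distanceMatrix i) B
  quotientMatrix-isQuotientOf {orb = orb} i Q .EquitablePartition.IsQuotientOf.cellSum u b =
    trans (sym (count-∧ (distIs adj i u) (λ z → ⌊ orb z ≟ b ⌋))) (Q u b)

  distanceMatrix-⊙ : ∀ {d pn} → IsDistanceRegular adj d pn →
                     ∀ x y k u w → distIs adj (toℕ k) u w ≡ true →
                     (distanceMatrix (toℕ x) ⊙ distanceMatrix (toℕ y)) u w ≡ pn x y k
  distanceMatrix-⊙ distanceRegular x y k u w dk =
    trans (sym (count-∧ (distIs adj (toℕ x) u) (λ z → distIs adj (toℕ y) z w)))
          (distanceRegular x y k u w dk)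

corollary5p2 : {c ℓ : Level} {N d n : ℕ}
  (adj : Graph N) → IsSimpleGraph adj → Connected adj → HasDiameter adj d →
  (pn : Fin (suc d) → Fin (suc d) → Fin (suc d) → ℕ) → IsDistanceRegular adj d pn →
  (G : (Fin N → Fin N) → Set) → IsAutomorphismGroup adj G →
  (orb : Fin N → Fin n) → IsOrbitLabelling G orb → EqualOrbitLengths orb →
  (M : Fin (suc d) → Fin n → Fin n → ℕ) →
  (∀ i → IsQuotientMatrix adj orb (toℕ i) (M i)) →
  (I : Subset (suc d)) →
  (p : ℕ) → Prime p →
  (∀ x y k → x ∈ I → y ∈ I → p ∣ pn x y k) →
  (m : ℕ) → 1 ≤ m →
  (F : CommutativeRing c ℓ) → IsField F →
  Inverse (CommutativeRing.setoid F) (setoid (Fin (p ^ m))) →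
  CommutativeRing._≈_ F (LinAlg.ι F p) (CommutativeRing.0# F) →
  LinAlg.IsSelfOrthogonalCode F (LinAlg.rowSpaceCode F M I)
corollary5p2 {d = d} {n} adj simple _ diameter pn distanceRegular _ _ orb labelling equalLengths
             M isQuotient I p _ p∣pn _ _ F _ _ ιp≈0 =
  RowOrthogonality.rowSpaceCode-selfOrthogonal F M I
    (λ x y x∈I y∈I → RowOrthogonality.reduce-rowOrthogonal F {B = M x} {M y} ιp≈0 (p∣MMᵀ x∈I y∈I))
  where
  open Distances adj
  open EquitablePartition orb
  surjective = IsOrbitLabelling.surjective labelling

  quotient : ∀ i → IsQuotientOf (distanceMatrix (toℕ i)) (M i)
  quotient i = quotientMatrix-isQuotientOf (toℕ i) (isQuotient i)

  M-symmetric : ∀ i b c → M i b c ≡ M i c b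
  M-symmetric i = quotient-symmetric surjective equalLengths
    (distanceMatrix-symmetric (IsSimpleGraph.symmetric simple) (toℕ i)) (quotient i)

  p∣MMᵀ : ∀ {x y} → x ∈ I → y ∈ I → ∀ a b → p ∣ ∑[ c < n ] (M x a c * M y b c)
  p∣MMᵀ {x} {y} x∈I y∈I a b =
    subst (p ∣_) (sum-cong-≗ (λ c → cong (M x a c *_) (M-symmetric y c b)))
      (quotient-∣ surjective (quotient-⊙ (quotient x) (quotient y)) p∣AA a b)
    where
    p∣AA : ∀ u w → p ∣ (distanceMatrix (toℕ x) ⊙ distanceMatrix (toℕ y)) u w
    p∣AA u w with distance d (proj₁ diameter u w)
    ... | k , dk = subst (p ∣_) (sym (distanceMatrix-⊙ distanceRegular x y k u w dk)) (p∣pn x y k x∈I y∈I)
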